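{- Let $\mathsf{M}$ be a loopless matroid on $E$ and $i\in E$ an element that is not a coloop. For a matroid $\mathsf{N}$ with ground set $E'$ define in the free $\mathbb{Z}[x,x^{ -1}]$-module $\mathcal{H}(\mathsf{N})$ with basis $\{\Gamma^G_{\mathsf{N}}\}_{G\in\mathcal{L}(\mathsf{N})}$ the element \[\xi^{E'}_{\mathsf{N}}:=\sum_{G\in\mathcal{L}(\mathsf{N})}x^{\operatorname{rk}(G)}\mu(\mathsf{N}/G)\cdot\Gamma^G_{\mathsf{N}}.\] Let $\Delta:\mathcal{H}(\mathsf{M})\to\mathcal{H}(\mathsf{M}\smallsetminus i)$ be the $\mathbb{Z}[x,x^{ -1}]$-linear map with $\Delta(\Gamma^F_{\mathsf{M}})=x^{\operatorname{rk}_{\mathsf{M}\smallsetminus i}(F\smallsetminus i)-\operatorname{rk}_{\mathsf{M}}(F)}\Gamma^{F\smallsetminus i}_{\mathsf{M}\smallsetminus i}$. Then $\Delta(\xi^E_{\mathsf{M}})=\xi^{E\smallsetminus i}_{\mathsf{M}\smallsetminus i}$.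
   Context: $\mathcal{L}(\mathsf{N})$ is the lattice of flats of $\mathsf{N}$, and $\mu(\mathsf{N}/G)$ is the Möbius function value $\mu(G,E')$ of $\mathcal{L}(\mathsf{N})$ (the Möbius invariant of the contraction). For a flat $F$ of $\mathsf{M}$, $F\smallsetminus i$ is a flat of $\mathsf{M}\smallsetminus i$. -}

module Defs where

open import Data.Bool using (Bool; true; false; _∧_; not; if_then_else_)
open import Data.Nat using (ℕ; zero; suc; _≤_; _+_; _<_)
import Data.Nat as ℕ
open import Data.Integer using (ℤ; +_; -_) renaming (_+_ to _+ℤ_; _-_ to _-ℤ_)
import Data.Integer as ℤ
open import Data.Fin using (Fin; zero; suc)
open import Data.Fin.Subset using (Subset; _∈_; _⊆_; _∪_; _∩_; _-_; _─_; ⁅_⁆; ∣_∣; inside; outside)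
open import Data.Fin.Subset.Properties using (_∈?_; _⊆?_)
open import Data.Fin.Subset.Properties using (⊆-trans)
open import Data.List using (List; []; _∷_; _++_; map; foldr)
open import Data.Vec using (Vec; []; _∷_)
import Data.Vec.Properties as VecP
import Data.Bool.Properties as BoolP
open import Data.Vec.Base using (here; there)
open import Data.Fin.Subset using (Subset)
open import Relation.Nullary.Decidable using (⌊_⌋)
open import Data.List.Base using (allFin)

record Matroid (n : ℕ) : Set where
  field
    ground   : Subset n
    rk       : Subset n → ℕ
    rk-bound : ∀ X → X ⊆ ground → rk X ≤ ∣ X ∣
    rk-mono  : ∀ X Y → Y ⊆ ground → X ⊆ Y → rk X ≤ rk Y
    rk-submod : ∀ X Y → X ⊆ ground → Y ⊆ ground →
                rk (X ∪ Y) + rk (X ∩ Y) ≤ rk X + rk Y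
open Matroid public

p─q⊆p : ∀ {n} (p q : Subset n) → p ─ q ⊆ p
p─q⊆p (x ∷ p) (inside ∷ q) (there m) = there (p─q⊆p p q m)
p─q⊆p (inside ∷ p) (outside ∷ q) here = here
p─q⊆p (x ∷ p) (outside ∷ q) (there m) = there (p─q⊆p p q m)

Loopless : ∀ {n} → Matroid n → Set
Loopless M = ∀ j → j ∈ ground M → 0 < rk M ⁅ j ⁆

IsColoop : ∀ {n} → Matroid n → Fin n → Set
IsColoop M i = rk M (ground M - i) < rk M (ground M)

_∖_ : ∀ {n} → Matroid n → Fin n → Matroid n
M ∖ i = record
  { ground = ground M - i
  ; rk = rk M
  ; rk-bound = λ X h → rk-bound M X (⊆-trans h (p─q⊆p _ _))
  ; rk-mono = λ X Y h → rk-mono M X Y (⊆-trans h (p─q⊆p _ _))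
  ; rk-submod = λ X Y hX hY → rk-submod M X Y (⊆-trans hX (p─q⊆p _ _)) (⊆-trans hY (p─q⊆p _ _))
  }

subsets : (n : ℕ) → List (Subset n)
subsets zero = [] ∷ []
subsets (suc n) = map (inside ∷_) (subsets n) ++ map (outside ∷_) (subsets n)

sumℤ : List ℤ → ℤ
sumℤ = foldr _+ℤ_ (+ 0)

ΣSub : ∀ {n} → (Subset n → Bool) → (Subset n → ℤ) → ℤ
ΣSub {n} P f = sumℤ (map (λ S → if P S then f S else + 0) (subsets n))

_==S_ : ∀ {n} → Subset n → Subset n → Bool
S ==S T = ⌊ VecP.≡-dec BoolP._≟_ S T ⌋

_⊆b_ : ∀ {n} → Subset n → Subset n → Bool
S ⊆b T = ⌊ S ⊆? T ⌋

_∈b_ : ∀ {n} → Fin n → Subset n → Bool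
j ∈b S = ⌊ j ∈? S ⌋

allB : ∀ {A : Set} → (A → Bool) → List A → Bool
allB p = foldr (λ a b → p a ∧ b) true

isFlat : ∀ {n} → Matroid n → Subset n → Bool
isFlat {n} N F = (F ⊆b ground N) ∧
  allB (λ j → if (j ∈b ground N) ∧ not (j ∈b F)
             then ⌊ rk N F ℕ.<? rk N (F ∪ ⁅ j ⁆) ⌋ else true) (allFin n)

-- Recursion is on a fuel parameter; since every
-- recursive call strictly shrinks H, fuel n+1 is always sufficient.
μ-fuel : ∀ {n} → ℕ → Matroid n → Subset n → Subset n → ℤ
μ-fuel zero N G H = + 0
μ-fuel (suc f) N G H =
  if G ==S H then + 1
  else if G ⊆b H
  then - ΣSub (λ K → isFlat N K ∧ (G ⊆b K) ∧ (K ⊆b H) ∧ not (K ==S H))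
              (λ K → μ-fuel f N G K)
  else + 0

μ : ∀ {n} → Matroid n → Subset n → Subset n → ℤ
μ {n} N G H = μ-fuel (suc n) N G H

-- μ(N/G) := μ_{L(N)}(G, E')
μ/ : ∀ {n} → Matroid n → Subset n → ℤ
μ/ N G = μ N G (ground N)

-- Elements of the free Z[x,x⁻¹]-module H(N) with basis {Γ^G}_{G ∈ L(N)}:
-- a vector is given by its coefficients, v G k = coefficient of x^k Γ^G
-- (coordinates at non-flats G are zero for genuine elements).
Hmod : ℕ → Set
Hmod n = Subset n → ℤ → ℤ

ξ : ∀ {n} → Matroid n → Hmod n
ξ N G k = if isFlat N G ∧ ⌊ k ℤ.≟ (+ rk N G) ⌋ then μ/ N G else + 0

-- Coefficient of x^k Γ^G in Δ v is Σ_{F ∈ L(M), F∖i = G} (coefficient of x^{k-d_F} in v F),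
-- where d_F = rk_{M∖i}(F∖i) - rk_M(F).
Δ : ∀ {n} → Matroid n → Fin n → Hmod n → Hmod n
Δ M i v G k =
  ΣSub (λ F → isFlat M F ∧ ((F - i) ==S G))
       (λ F → v F (k -ℤ ((+ rk (M ∖ i) (F - i)) -ℤ (+ rk M F))))

module Submission where

-- Deletion does not change ranks, so Δ moves the term x^rk(F) μ(M/F) Γ^F of ξ_M to x^rk(G) μ(M/F) Γ^G
-- with G = F ∖ i; the coefficient of Γ^G in Δ(ξ_M) is x^rk(G) times Σ_{F ∈ L(M), F ∖ i = G} μ(F, E).
-- The maps F ↦ F ∖ i from L(M) to L(M ∖ i) and y ↦ cl_M(y) back form a Galois connection
-- (cl_M(y) ⊆ X iff y ⊆ X ∖ i), so by Rota's theorem this sum equals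
-- Σ_{y ∈ L(M ∖ i), cl_M(y) = E} μ_{M∖i}(G, y); as i is not a coloop, E ∖ i is the only flat of M ∖ i
-- spanning E, which leaves μ((M ∖ i)/G). Rota's theorem holds because, as functions of a flat X of M,
-- both sides have the same sums over the flats below X, namely [X ∖ i = G], and such sums
-- determine a function on L(M).

open import Defs
open import Data.Bool using (Bool; true; false; T; _∧_; not; if_then_else_)
import Data.Bool.Properties as Bool
open import Data.Bool.Properties using (T-∧; T-≡; T-not-≡; ∧-identityʳ)
open import Data.Empty using (⊥-elim)
open import Data.Fin using (Fin; _≟_)
open import Data.Fin.Subset
  using (Subset; _∈_; _∉_; _⊆_; _⊂_; _∪_; _∩_; _-_; _─_; ⁅_⁆; ∣_∣; inside; outside)
open import Data.Fin.Subset.Induction using (⊂-wellFounded)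
open import Data.Fin.Subset.Properties
  using (_∈?_; _⊆?_; ∣p∣≤n; ⊆-refl; ⊆-reflexive; ⊆-trans; ⊆-antisym; drop-∷-⊆; out⊂; out⊂in; s⊂s;
         p⊂q⇒∣p∣<∣q∣; x∈p∧x≢y⇒x∈p-y; x∈⁅x⁆; x∈⁅y⁆⇒x≡y; x∈p∪q⁻; p⊆p∪q; q⊆p∪q; p∩q⊆p; x∈p∩q⁺)
open import Data.Integer using (ℤ; +_; -_; _+_)
import Data.Integer as ℤ
import Data.Integer.Properties as ℤ
open import Data.Integer.Tactic.RingSolver using (solve-∀)
open import Algebra.Properties.AbelianGroup ℤ.+-0-abelianGroup using (∙-cancelʳ)
open import Algebra.Properties.CommutativeSemigroup ℤ.+-commutativeSemigroup using (interchange)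
open import Data.List using (List; []; _∷_; _++_; map; allFin)
import Data.List.Properties as List
import Data.List.Membership.Propositional as List
open import Data.List.Membership.Propositional.Properties using (∈-allFin)
open import Data.List.Relation.Unary.Any using (here; there)
open import Data.Nat using (ℕ; zero; suc; _≤_; _<_; s≤s)
import Data.Nat as ℕ
import Data.Nat.Properties as ℕ
open import Data.Product using (_×_; _,_; proj₁; proj₂)
open import Data.Sum using ([_,_])
open import Data.Vec using ([]; _∷_)
open import Data.Vec.Base using (here; there)
import Data.Vec.Properties as Vec
open import Function using (_∘_; _⇔_; mk⇔; Equivalence; case_of_)
open import Induction.WellFounded using (Acc; acc)
open import Relation.Binary.PropositionalEquality
  using (_≡_; _≢_; refl; sym; trans; cong; cong₂; subst; module ≡-Reasoning)
open import Relation.Nullary using (¬_; Dec; yes; no)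
open import Relation.Nullary.Decidable
  using (⌊_⌋; toWitness; fromWitness; toWitnessFalse; fromWitnessFalse)

open ≡-Reasoning

private
  variable
    n : ℕ
    A B : Set

T-∧⁻ : ∀ a {b} → T (a ∧ b) → T a × T b
T-∧⁻ true t = _ , t

T⇒≡true : ∀ {b} → T b → b ≡ true
T⇒≡true = Equivalence.to T-≡

T-guarded⁺ : ∀ a b c → (T a → ¬ T b → T c) → T (if a ∧ not b then c else true)
T-guarded⁺ true  false c c-holds = c-holds _ (λ ())
T-guarded⁺ true  true  c _       = _
T-guarded⁺ false b     c _       = _

T-guarded⁻ : ∀ a b c → T (if a ∧ not b then c else true) → T a → ¬ T b → T c
T-guarded⁻ true false c t _ _  = t
T-guarded⁻ true true  c _ _ ¬b = ⊥-elim (¬b _)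

⌊⌋-true : ∀ (a? : Dec A) → A → ⌊ a? ⌋ ≡ true
⌊⌋-true a? a = Equivalence.to T-≡ (fromWitness {a? = a?} a)

⌊⌋-false : ∀ (a? : Dec A) → ¬ A → ⌊ a? ⌋ ≡ false
⌊⌋-false a? ¬a = Equivalence.to T-not-≡ (fromWitnessFalse {a? = a?} ¬a)

⌊⌋-⇔ : A ⇔ B → (a? : Dec A) (b? : Dec B) → ⌊ a? ⌋ ≡ ⌊ b? ⌋
⌊⌋-⇔ A⇔B a? (yes b) = ⌊⌋-true a? (Equivalence.from A⇔B b)
⌊⌋-⇔ A⇔B a? (no ¬b) = ⌊⌋-false a? (¬b ∘ Equivalence.to A⇔B)

_≟ₛ_ : (S S′ : Subset n) → Dec (S ≡ S′)
_≟ₛ_ = Vec.≡-dec Bool._≟_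

==S-refl : ∀ (S : Subset n) → S ==S S ≡ true
==S-refl S = ⌊⌋-true (S ≟ₛ S) refl

⊆⇒⊆b : ∀ {S S′ : Subset n} → S ⊆ S′ → T (S ⊆b S′)
⊆⇒⊆b {S = S} {S′} = fromWitness {a? = S ⊆? S′}

⊆b⇒⊆ : ∀ {S S′ : Subset n} → T (S ⊆b S′) → S ⊆ S′
⊆b⇒⊆ {S = S} {S′} = toWitness {a? = S ⊆? S′}

∧-shuffle : ∀ a b c d → ((a ∧ b) ∧ c) ∧ d ≡ a ∧ c ∧ b ∧ d
∧-shuffle false b     c     d = refl
∧-shuffle true  true  true  d = refl
∧-shuffle true  true  false d = refl
∧-shuffle true  false true  d = refl
∧-shuffle true  false false d = refl

if-true : ∀ {b} {x y : ℤ} → T b → (if b then x else y) ≡ x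
if-true {true} _ = refl

if-intro : ∀ b {x y : ℤ} → (T b → y ≡ x) → (¬ T b → y ≡ + 0) → y ≡ (if b then x else + 0)
if-intro true  y≡x _   = y≡x _
if-intro false _   y≡0 = y≡0 (λ ())

if-cong : ∀ b {x y : ℤ} → (T b → x ≡ y) → (if b then x else + 0) ≡ (if b then y else + 0)
if-cong true  x≡y = x≡y _
if-cong false _   = refl

if-zero : ∀ b {x : ℤ} → (T b → x ≡ + 0) → (if b then x else + 0) ≡ + 0
if-zero true  x≡0 = x≡0 _
if-zero false _   = refl

if-∧ : ∀ a b {x : ℤ} → (if a then (if b then x else + 0) else + 0) ≡ (if a ∧ b then x else + 0)
if-∧ true  b = refl
if-∧ false b = refl

if-swap : ∀ a b {x : ℤ} →
  (if a then (if b then x else + 0) else + 0) ≡ (if b then (if a then x else + 0) else + 0)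
if-swap true  b     = refl
if-swap false true  = refl
if-swap false false = refl

if-restrict : ∀ a b {x : ℤ} → (T a → ¬ T b → x ≡ + 0) →
  (if a then x else + 0) ≡ (if a ∧ b then x else + 0)
if-restrict true  true  _   = refl
if-restrict true  false x≡0 = x≡0 _ (λ ())
if-restrict false b     _   = refl

if-split : ∀ a b {x : ℤ} → (T b → T a) →
  (if a then x else + 0) ≡ (if b then x else + 0) + (if a ∧ not b then x else + 0)
if-split true  true  _   = sym (ℤ.+-identityʳ _)
if-split true  false _   = sym (ℤ.+-identityˡ _)
if-split false true  b⇒a = ⊥-elim (b⇒a _)
if-split false false _   = refl

sumOver : List A → (A → ℤ) → ℤ
sumOver xs f = sumℤ (map f xs)

sumOver-cong : ∀ (xs : List A) {f g} → (∀ x → f x ≡ g x) → sumOver xs f ≡ sumOver xs g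
sumOver-cong xs f≗g = cong sumℤ (List.map-cong f≗g xs)

sumOver-zero : ∀ (xs : List A) → sumOver xs (λ _ → + 0) ≡ + 0
sumOver-zero []       = refl
sumOver-zero (x ∷ xs) = trans (ℤ.+-identityˡ _) (sumOver-zero xs)

sumOver-++ : ∀ (xs ys : List A) f → sumOver (xs ++ ys) f ≡ sumOver xs f + sumOver ys f
sumOver-++ []       ys f = sym (ℤ.+-identityˡ _)
sumOver-++ (x ∷ xs) ys f = trans (cong (_+_ (f x)) (sumOver-++ xs ys f)) (sym (ℤ.+-assoc (f x) _ _))

sumOver-map : ∀ (xs : List A) (g : A → B) f → sumOver (map g xs) f ≡ sumOver xs (f ∘ g)
sumOver-map xs g f = cong sumℤ (sym (List.map-∘ xs))

sumOver-+ : ∀ (xs : List A) f g → sumOver xs (λ x → f x + g x) ≡ sumOver xs f + sumOver xs g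
sumOver-+ []       f g = refl
sumOver-+ (x ∷ xs) f g =
  trans (cong (_+_ (f x + g x)) (sumOver-+ xs f g)) (interchange (f x) (g x) _ _)

sumOver-if : ∀ (xs : List A) b f →
  (if b then sumOver xs f else + 0) ≡ sumOver xs (λ x → if b then f x else + 0)
sumOver-if xs true  f = refl
sumOver-if xs false f = sym (sumOver-zero xs)

sumOver-comm : ∀ (xs : List A) (ys : List B) (f : A → B → ℤ) →
  sumOver xs (λ x → sumOver ys (f x)) ≡ sumOver ys (λ y → sumOver xs (λ x → f x y))
sumOver-comm []       ys f = sym (sumOver-zero ys)
sumOver-comm (x ∷ xs) ys f = trans (cong (_+_ (sumOver ys (f x))) (sumOver-comm xs ys f))
                                   (sym (sumOver-+ ys (f x) (λ y → sumOver xs (λ x → f x y))))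

-- Sums over subsets

ΣSub-cong : ∀ (P : Subset n → Bool) {f g} → (∀ S → T (P S) → f S ≡ g S) → ΣSub P f ≡ ΣSub P g
ΣSub-cong {n} P f≗g = sumOver-cong (subsets n) (λ S → if-cong (P S) (f≗g S))

ΣSub-cong-guard : ∀ {P Q : Subset n → Bool} f → (∀ S → P S ≡ Q S) → ΣSub P f ≡ ΣSub Q f
ΣSub-cong-guard {n} f P≗Q = sumOver-cong (subsets n) (λ S → cong (λ b → if b then f S else + 0) (P≗Q S))

ΣSub-zero : ∀ (P : Subset n → Bool) {f} → (∀ S → T (P S) → f S ≡ + 0) → ΣSub P f ≡ + 0
ΣSub-zero {n} P f≗0 = trans (sumOver-cong (subsets n) (λ S → if-zero (P S) (f≗0 S))) (sumOver-zero (subsets n))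

ΣSub-filter : ∀ (P Q : Subset n → Bool) f →
  ΣSub P (λ S → if Q S then f S else + 0) ≡ ΣSub (λ S → P S ∧ Q S) f
ΣSub-filter {n} P Q f = sumOver-cong (subsets n) (λ S → if-∧ (P S) (Q S))

ΣSub-restrict : ∀ (P Q : Subset n → Bool) {f} → (∀ S → T (P S) → ¬ T (Q S) → f S ≡ + 0) →
  ΣSub P f ≡ ΣSub (λ S → P S ∧ Q S) f
ΣSub-restrict {n} P Q f≡0 = sumOver-cong (subsets n) (λ S → if-restrict (P S) (Q S) (f≡0 S))

ΣSub-if : ∀ (P : Subset n → Bool) b f →
  ΣSub P (λ S → if b then f S else + 0) ≡ (if b then ΣSub P f else + 0)
ΣSub-if {n} P b f = trans (sumOver-cong (subsets n) (λ S → if-swap (P S) b)) (sym (sumOver-if (subsets n) b _))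

ΣSub-comm : ∀ (P Q : Subset n → Bool) (f : Subset n → Subset n → ℤ) →
  ΣSub P (λ S → ΣSub Q (f S)) ≡ ΣSub Q (λ S′ → ΣSub P (λ S → f S S′))
ΣSub-comm {n} P Q f = begin
  ΣSub P (λ S → ΣSub Q (f S))
    ≡⟨ sumOver-cong (subsets n) (λ S → sumOver-if (subsets n) (P S) _) ⟩
  sumOver (subsets n) (λ S → sumOver (subsets n) (λ S′ → if P S then (if Q S′ then f S S′ else + 0) else + 0))
    ≡⟨ sumOver-comm (subsets n) (subsets n) _ ⟩
  sumOver (subsets n) (λ S′ → sumOver (subsets n) (λ S → if P S then (if Q S′ then f S S′ else + 0) else + 0))
    ≡⟨ sumOver-cong (subsets n) (λ S′ → sumOver-cong (subsets n) (λ S → if-swap (P S) (Q S′))) ⟩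
  sumOver (subsets n) (λ S′ → sumOver (subsets n) (λ S → if Q S′ then (if P S then f S S′ else + 0) else + 0))
    ≡⟨ sumOver-cong (subsets n) (λ S′ → sym (sumOver-if (subsets n) (Q S′) _)) ⟩
  ΣSub Q (λ S′ → ΣSub P (λ S → f S S′)) ∎

ΣSub-suc : ∀ (P : Subset (suc n) → Bool) f → ΣSub P f ≡
  ΣSub (P ∘ (inside ∷_)) (f ∘ (inside ∷_)) + ΣSub (P ∘ (outside ∷_)) (f ∘ (outside ∷_))
ΣSub-suc {n} P f = trans (sumOver-++ (map (inside ∷_) (subsets n)) _ _)
  (cong₂ _+_ (sumOver-map (subsets n) (inside ∷_) _) (sumOver-map (subsets n) (outside ∷_) _))

ΣSub-unique : ∀ {P : Subset n → Bool} {f} {X} → (∀ S → T (P S) → S ≡ X) →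
  ΣSub P f ≡ (if P X then f X else + 0)
ΣSub-unique {zero}  {X = []} _ = ℤ.+-identityʳ _
ΣSub-unique {suc n} {P} {f} {inside ∷ X} only-X = begin
  ΣSub P f
    ≡⟨ ΣSub-suc P f ⟩
  ΣSub (P ∘ (inside ∷_)) (f ∘ (inside ∷_)) + ΣSub (P ∘ (outside ∷_)) (f ∘ (outside ∷_))
    ≡⟨ cong₂ _+_ (ΣSub-unique (λ S p → Vec.∷-injectiveʳ (only-X _ p)))
                 (ΣSub-zero (P ∘ (outside ∷_)) (λ S p → ⊥-elim (outside≢inside (only-X _ p)))) ⟩
  (if P (inside ∷ X) then f (inside ∷ X) else + 0) + + 0
    ≡⟨ ℤ.+-identityʳ _ ⟩
  (if P (inside ∷ X) then f (inside ∷ X) else + 0) ∎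
  where
  outside≢inside : ∀ {S} → outside ∷ S ≢ inside ∷ X
  outside≢inside ()
ΣSub-unique {suc n} {P} {f} {outside ∷ X} only-X = begin
  ΣSub P f
    ≡⟨ ΣSub-suc P f ⟩
  ΣSub (P ∘ (inside ∷_)) (f ∘ (inside ∷_)) + ΣSub (P ∘ (outside ∷_)) (f ∘ (outside ∷_))
    ≡⟨ cong₂ _+_ (ΣSub-zero (P ∘ (inside ∷_)) (λ S p → ⊥-elim (inside≢outside (only-X _ p))))
                 (ΣSub-unique (λ S p → Vec.∷-injectiveʳ (only-X _ p))) ⟩
  + 0 + (if P (outside ∷ X) then f (outside ∷ X) else + 0)
    ≡⟨ ℤ.+-identityˡ _ ⟩
  (if P (outside ∷ X) then f (outside ∷ X) else + 0) ∎
  where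
  inside≢outside : ∀ {S} → inside ∷ S ≢ outside ∷ X
  inside≢outside ()

ΣSub-remove : ∀ (P : Subset n → Bool) {f} X → T (P X) →
  ΣSub P f ≡ f X + ΣSub (λ S → P S ∧ not (S ==S X)) f
ΣSub-remove {n} P {f} X PX = begin
  ΣSub P f
    ≡⟨ sumOver-cong (subsets n) (λ S →
         if-split (P S) (S ==S X) (λ S≡X → subst (T ∘ P) (sym (toWitness S≡X)) PX)) ⟩
  sumOver (subsets n) (λ S → (if S ==S X then f S else + 0) + (if P S ∧ not (S ==S X) then f S else + 0))
    ≡⟨ sumOver-+ (subsets n) _ _ ⟩
  ΣSub (_==S X) f + rest
    ≡⟨ cong (_+ rest) (ΣSub-unique {P = _==S X} {f} (λ S → toWitness)) ⟩
  (if X ==S X then f X else + 0) + rest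
    ≡⟨ cong (λ b → (if b then f X else + 0) + rest) (==S-refl X) ⟩
  f X + rest ∎
  where
  rest = ΣSub (λ S → P S ∧ not (S ==S X)) f

δ : Subset n → Subset n → ℤ
δ S S′ = if S ==S S′ then + 1 else + 0

δ-refl : ∀ (S : Subset n) → δ S S ≡ + 1
δ-refl S = cong (λ b → if b then + 1 else + 0) (==S-refl S)

δ-≢ : ∀ {S S′ : Subset n} → S ≢ S′ → δ S S′ ≡ + 0
δ-≢ {S = S} {S′} S≢S′ = cong (λ b → if b then + 1 else + 0) (⌊⌋-false (S ≟ₛ S′) S≢S′)

δ-sym : ∀ (S S′ : Subset n) → δ S S′ ≡ δ S′ S
δ-sym S S′ with S ≟ₛ S′
... | yes refl = sym (δ-refl S)
... | no S≢S′  = sym (δ-≢ (S≢S′ ∘ sym))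

ΣSub-δ : ∀ (P : Subset n → Bool) X → ΣSub P (λ S → δ S X) ≡ (if P X then + 1 else + 0)
ΣSub-δ P X = begin
  ΣSub P (λ S → δ S X)                    ≡⟨ ΣSub-filter P (_==S X) (λ _ → + 1) ⟩
  ΣSub (λ S → P S ∧ S ==S X) (λ _ → + 1)  ≡⟨ ΣSub-unique (λ S S∈ → toWitness (proj₂ (T-∧⁻ (P S) S∈))) ⟩
  (if P X ∧ X ==S X then + 1 else + 0)    ≡⟨ cong (λ b → if P X ∧ b then + 1 else + 0) (==S-refl X) ⟩
  (if P X ∧ true then + 1 else + 0)       ≡⟨ cong (λ b → if b then + 1 else + 0) (∧-identityʳ (P X)) ⟩
  (if P X then + 1 else + 0)              ∎

⊆∧≢⇒⊂ : ∀ {p q : Subset n} → p ⊆ q → p ≢ q → p ⊂ q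
⊆∧≢⇒⊂ {p = []}          {[]}          _   p≢q = ⊥-elim (p≢q refl)
⊆∧≢⇒⊂ {p = outside ∷ p} {outside ∷ q} p⊆q p≢q = out⊂ (⊆∧≢⇒⊂ (drop-∷-⊆ p⊆q) (p≢q ∘ cong (outside ∷_)))
⊆∧≢⇒⊂ {p = outside ∷ p} {inside  ∷ q} p⊆q _   = out⊂in (drop-∷-⊆ p⊆q)
⊆∧≢⇒⊂ {p = inside  ∷ p} {outside ∷ q} p⊆q _   with () ← p⊆q here
⊆∧≢⇒⊂ {p = inside  ∷ p} {inside  ∷ q} p⊆q p≢q = s⊂s (⊆∧≢⇒⊂ (drop-∷-⊆ p⊆q) (p≢q ∘ cong (inside ∷_)))

downward-sums-determine : ∀ (L : Subset n → Bool) (f g : Subset n → ℤ) →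
  (∀ X → T (L X) → ΣSub (λ H → L H ∧ H ⊆b X) f ≡ ΣSub (λ H → L H ∧ H ⊆b X) g) →
  ∀ X → T (L X) → f X ≡ g X
downward-sums-determine {n} L f g sums≡ X = go X (⊂-wellFounded X)
  where
  below : Subset n → Subset n → Bool
  below X H = L H ∧ H ⊆b X

  go : ∀ X → Acc _⊂_ X → T (L X) → f X ≡ g X
  go X (acc rec) LX = ∙-cancelʳ (ΣSub strictly-below g) (f X) (g X) (begin
    f X + ΣSub strictly-below g  ≡⟨ cong (_+_ (f X)) (sym (ΣSub-cong strictly-below by-induction)) ⟩
    f X + ΣSub strictly-below f  ≡⟨ sym (ΣSub-remove (below X) X X-below) ⟩
    ΣSub (below X) f             ≡⟨ sums≡ X LX ⟩
    ΣSub (below X) g             ≡⟨ ΣSub-remove (below X) X X-below ⟩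
    g X + ΣSub strictly-below g  ∎)
    where
    strictly-below : Subset n → Bool
    strictly-below H = below X H ∧ not (H ==S X)
    X-below : T (below X X)
    X-below = Equivalence.from T-∧ (LX , ⊆⇒⊆b ⊆-refl)
    by-induction : ∀ H → T (strictly-below H) → f H ≡ g H
    by-induction H H<X =
      let (H-below , H≢X) = T-∧⁻ (below X H) H<X
          (LH , H⊆X)      = T-∧⁻ (L H) H-below
      in go H (rec (⊆∧≢⇒⊂ (⊆b⇒⊆ H⊆X) (toWitnessFalse {a? = H ≟ₛ X} H≢X))) LH

-- Möbius functions of lattices of flats

module Möbius (N : Matroid n) where

  flats≤ : Subset n → Subset n → Bool
  flats≤ X H = isFlat N H ∧ H ⊆b X

  flats[_,_] : Subset n → Subset n → Subset n → Bool
  flats[ G , X ] H = flats≤ X H ∧ G ⊆b H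

  flats[_,_⟩ : Subset n → Subset n → Subset n → Bool
  flats[ G , X ⟩ K = isFlat N K ∧ G ⊆b K ∧ K ⊆b X ∧ not (K ==S X)

  flats[,⟩⇒⊂ : ∀ {G X K} → T (flats[ G , X ⟩ K) → K ⊂ X
  flats[,⟩⇒⊂ {G} {X} {K} K∈ =
    let (_ , rest)  = T-∧⁻ (isFlat N K) K∈
        (_ , rest′) = T-∧⁻ (G ⊆b K) rest
        (K⊆X , K≢X) = T-∧⁻ (K ⊆b X) rest′
    in ⊆∧≢⇒⊂ (⊆b⇒⊆ K⊆X) (toWitnessFalse {a? = K ≟ₛ X} K≢X)

  μ-fuel-stable : ∀ f f′ {G H} → ∣ H ∣ < f → ∣ H ∣ < f′ → μ-fuel f N G H ≡ μ-fuel f′ N G H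
  μ-fuel-stable (suc f) (suc f′) {G} {H} (s≤s H<f) (s≤s H<f′) =
    cong (λ s → if G ==S H then + 1 else if G ⊆b H then - s else + 0) (ΣSub-cong flats[ G , H ⟩ λ K K∈ →
      let K<H = p⊂q⇒∣p∣<∣q∣ (flats[,⟩⇒⊂ {G} {H} {K} K∈)
      in μ-fuel-stable f f′ (ℕ.<-≤-trans K<H H<f) (ℕ.<-≤-trans K<H H<f′))

  μ-diagonal : ∀ G → μ N G G ≡ + 1
  μ-diagonal G =
    cong (λ b → if b then + 1 else if G ⊆b G then - ΣSub flats[ G , G ⟩ (μ-fuel n N G) else + 0)
         (==S-refl G)

  μ-vanishes : ∀ {G H} → ¬ G ⊆ H → μ N G H ≡ + 0
  μ-vanishes {G} {H} G⊈H =
    cong₂ (λ a b → if a then + 1 else if b then - ΣSub flats[ G , H ⟩ (μ-fuel n N G) else + 0)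
          (⌊⌋-false (G ≟ₛ H) (G⊈H ∘ ⊆-reflexive)) (⌊⌋-false (G ⊆? H) G⊈H)

  μ-recursion : ∀ {G X} → G ⊆ X → G ≢ X → μ N G X ≡ - ΣSub flats[ G , X ⟩ (μ N G)
  μ-recursion {G} {X} G⊆X G≢X = begin
    μ N G X
      ≡⟨ cong₂ (λ a b → if a then + 1 else if b then - ΣSub flats[ G , X ⟩ (μ-fuel n N G) else + 0)
               (⌊⌋-false (G ≟ₛ X) G≢X) (⌊⌋-true (G ⊆? X) G⊆X) ⟩
    - ΣSub flats[ G , X ⟩ (μ-fuel n N G)
      ≡⟨ cong -_ (ΣSub-cong flats[ G , X ⟩ λ K K∈ →
           let K<X = p⊂q⇒∣p∣<∣q∣ (flats[,⟩⇒⊂ {G} {X} {K} K∈)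
               K<n = ℕ.<-≤-trans K<X (∣p∣≤n X)
           in μ-fuel-stable n (suc n) K<n (ℕ.m<n⇒m<1+n K<n)) ⟩
    - ΣSub flats[ G , X ⟩ (μ N G) ∎

  μ-interval-sum : ∀ G X → T (isFlat N X) → ΣSub flats[ G , X ] (μ N G) ≡ δ G X
  μ-interval-sum G X X-flat = case G ≟ₛ X of λ where
    (yes refl) → begin
      ΣSub flats[ G , G ] (μ N G)
        ≡⟨ ΣSub-unique (λ H H∈ → let (H≤G , G⊆H) = T-∧⁻ (flats≤ G H) H∈
                                 in ⊆-antisym (⊆b⇒⊆ (proj₂ (T-∧⁻ (isFlat N H) H≤G))) (⊆b⇒⊆ G⊆H)) ⟩
      (if flats[ G , G ] G then μ N G G else + 0)
        ≡⟨ if-true (Equivalence.from T-∧ (Equivalence.from T-∧ (X-flat , ⊆⇒⊆b ⊆-refl) , ⊆⇒⊆b ⊆-refl)) ⟩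
      μ N G G  ≡⟨ μ-diagonal G ⟩
      + 1      ≡⟨ sym (δ-refl G) ⟩
      δ G G    ∎
    (no G≢X) → case G ⊆? X of λ where
      (yes G⊆X) → begin
        ΣSub flats[ G , X ] (μ N G)
          ≡⟨ ΣSub-remove flats[ G , X ] X
               (Equivalence.from T-∧ (Equivalence.from T-∧ (X-flat , ⊆⇒⊆b ⊆-refl) , ⊆⇒⊆b G⊆X)) ⟩
        μ N G X + ΣSub (λ H → flats[ G , X ] H ∧ not (H ==S X)) (μ N G)
          ≡⟨ cong₂ _+_ (μ-recursion G⊆X G≢X) (ΣSub-cong-guard (μ N G) λ H →
               ∧-shuffle (isFlat N H) (H ⊆b X) (G ⊆b H) (not (H ==S X))) ⟩
        - ΣSub flats[ G , X ⟩ (μ N G) + ΣSub flats[ G , X ⟩ (μ N G)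
          ≡⟨ ℤ.+-inverseˡ (ΣSub flats[ G , X ⟩ (μ N G)) ⟩
        + 0    ≡⟨ sym (δ-≢ G≢X) ⟩
        δ G X  ∎
      (no G⊈X) → trans
        (ΣSub-zero flats[ G , X ] λ H H∈ →
          let (H≤X , G⊆H) = T-∧⁻ (flats≤ X H) H∈
          in ⊥-elim (G⊈X (⊆-trans (⊆b⇒⊆ G⊆H) (⊆b⇒⊆ (proj₂ (T-∧⁻ (isFlat N H) H≤X))))))
        (sym (δ-≢ G≢X))

  μ-sum-below : ∀ G X → T (isFlat N X) → ΣSub (flats≤ X) (μ N G) ≡ δ G X
  μ-sum-below G X X-flat =
    trans (ΣSub-restrict (flats≤ X) (G ⊆b_) (λ H _ G⊈H → μ-vanishes (G⊈H ∘ ⊆⇒⊆b)))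
          (μ-interval-sum G X X-flat)

module _ (N₁ N₂ : Matroid n) (φ ψ : Subset n → Subset n)
         (φ-flat : ∀ {X} → T (isFlat N₁ X) → T (isFlat N₂ (φ X)))
         (ψ-flat : ∀ {y} → T (isFlat N₂ y) → T (isFlat N₁ (ψ y)))
         (ψ⊣φ : ∀ {y X} → T (isFlat N₂ y) → T (isFlat N₁ X) → ψ y ⊆ X ⇔ y ⊆ φ X)
         where

  private
    module M₁ = Möbius N₁
    module M₂ = Möbius N₂

  rota-galois : ∀ G X → T (isFlat N₁ X) →
    ΣSub (λ F → isFlat N₁ F ∧ φ F ==S G) (λ F → μ N₁ F X) ≡ ΣSub (λ y → isFlat N₂ y ∧ ψ y ==S X) (μ N₂ G)
  rota-galois G = downward-sums-determine (isFlat N₁) fibre-sum image-sum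
    (λ X X-flat → trans (fibre-sums-below X X-flat)
                        (trans (δ-sym (φ X) G) (sym (image-sums-below X X-flat))))
    where
    fibre : Subset n → Bool
    fibre F = isFlat N₁ F ∧ φ F ==S G

    fibre-sum image-sum : Subset n → ℤ
    fibre-sum H = ΣSub fibre (λ F → μ N₁ F H)
    image-sum H = ΣSub (λ y → isFlat N₂ y ∧ ψ y ==S H) (μ N₂ G)

    fibre-sums-below : ∀ X → T (isFlat N₁ X) → ΣSub (M₁.flats≤ X) fibre-sum ≡ δ (φ X) G
    fibre-sums-below X X-flat = begin
      ΣSub (M₁.flats≤ X) fibre-sum
        ≡⟨ ΣSub-comm (M₁.flats≤ X) fibre (λ H F → μ N₁ F H) ⟩
      ΣSub fibre (λ F → ΣSub (M₁.flats≤ X) (μ N₁ F))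
        ≡⟨ ΣSub-cong fibre (λ F _ → M₁.μ-sum-below F X X-flat) ⟩
      ΣSub fibre (λ F → δ F X)
        ≡⟨ ΣSub-δ fibre X ⟩
      (if isFlat N₁ X ∧ φ X ==S G then + 1 else + 0)
        ≡⟨ cong (λ b → if b ∧ φ X ==S G then + 1 else + 0) (T⇒≡true X-flat) ⟩
      δ (φ X) G ∎

    image-sums-below : ∀ X → T (isFlat N₁ X) → ΣSub (M₁.flats≤ X) image-sum ≡ δ G (φ X)
    image-sums-below X X-flat = begin
      ΣSub (M₁.flats≤ X) image-sum
        ≡⟨ ΣSub-cong (M₁.flats≤ X) (λ H _ → sym (ΣSub-filter (isFlat N₂) (λ y → ψ y ==S H) (μ N₂ G))) ⟩
      ΣSub (M₁.flats≤ X) (λ H → ΣSub (isFlat N₂) (λ y → if ψ y ==S H then μ N₂ G y else + 0))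
        ≡⟨ ΣSub-comm (M₁.flats≤ X) (isFlat N₂) (λ H y → if ψ y ==S H then μ N₂ G y else + 0) ⟩
      ΣSub (isFlat N₂) (λ y → ΣSub (M₁.flats≤ X) (λ H → if ψ y ==S H then μ N₂ G y else + 0))
        ≡⟨ ΣSub-cong (isFlat N₂) ψ-below ⟩
      ΣSub (isFlat N₂) (λ y → if y ⊆b φ X then μ N₂ G y else + 0)
        ≡⟨ ΣSub-filter (isFlat N₂) (_⊆b φ X) (μ N₂ G) ⟩
      ΣSub (M₂.flats≤ (φ X)) (μ N₂ G)
        ≡⟨ M₂.μ-sum-below G (φ X) (φ-flat X-flat) ⟩
      δ G (φ X) ∎
      where
      ψ-below : ∀ y → T (isFlat N₂ y) →
        ΣSub (M₁.flats≤ X) (λ H → if ψ y ==S H then μ N₂ G y else + 0) ≡ (if y ⊆b φ X then μ N₂ G y else + 0)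
      ψ-below y y-flat = begin
        ΣSub (M₁.flats≤ X) (λ H → if ψ y ==S H then μ N₂ G y else + 0)
          ≡⟨ ΣSub-filter (M₁.flats≤ X) (ψ y ==S_) (λ _ → μ N₂ G y) ⟩
        ΣSub (λ H → M₁.flats≤ X H ∧ ψ y ==S H) (λ _ → μ N₂ G y)
          ≡⟨ ΣSub-unique (λ H H∈ → sym (toWitness (proj₂ (T-∧⁻ (M₁.flats≤ X H) H∈)))) ⟩
        (if M₁.flats≤ X (ψ y) ∧ ψ y ==S ψ y then μ N₂ G y else + 0)
          ≡⟨ cong (λ b → if b then μ N₂ G y else + 0) guard≡ ⟩
        (if y ⊆b φ X then μ N₂ G y else + 0) ∎
        where
        guard≡ : M₁.flats≤ X (ψ y) ∧ ψ y ==S ψ y ≡ y ⊆b φ X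
        guard≡ = begin
          (isFlat N₁ (ψ y) ∧ ψ y ⊆b X) ∧ ψ y ==S ψ y ≡⟨ cong (M₁.flats≤ X (ψ y) ∧_) (==S-refl (ψ y)) ⟩
          (isFlat N₁ (ψ y) ∧ ψ y ⊆b X) ∧ true       ≡⟨ ∧-identityʳ _ ⟩
          isFlat N₁ (ψ y) ∧ ψ y ⊆b X                ≡⟨ cong (_∧ ψ y ⊆b X) (T⇒≡true (ψ-flat y-flat)) ⟩
          ψ y ⊆b X                                  ≡⟨ ⌊⌋-⇔ (ψ⊣φ y-flat X-flat) (ψ y ⊆? X) (y ⊆? φ X) ⟩
          y ⊆b φ X                                  ∎

-- Flats and rank

∪-least : ∀ {p q r : Subset n} → p ⊆ r → q ⊆ r → p ∪ q ⊆ r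
∪-least {p = p} {q} p⊆r q⊆r x∈p∪q = [ p⊆r , q⊆r ] (x∈p∪q⁻ p q x∈p∪q)

x∈p⇒⁅x⁆⊆p : ∀ {x : Fin n} {p} → x ∈ p → ⁅ x ⁆ ⊆ p
x∈p⇒⁅x⁆⊆p {x = x} {p} x∈p y∈⁅x⁆ = subst (_∈ p) (sym (x∈⁅y⁆⇒x≡y x y∈⁅x⁆)) x∈p

x∈p─q⇒x∉q : ∀ {x : Fin n} (p q : Subset n) → x ∈ p ─ q → x ∉ q
x∈p─q⇒x∉q (_ ∷ p) (inside  ∷ q) (there x∈p─q) (there x∈q) = x∈p─q⇒x∉q p q x∈p─q x∈q
x∈p─q⇒x∉q (_ ∷ p) (outside ∷ q) (there x∈p─q) (there x∈q) = x∈p─q⇒x∉q p q x∈p─q x∈q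

x∈p-y⇒x≢y : ∀ {x y : Fin n} (p : Subset n) → x ∈ p - y → x ≢ y
x∈p-y⇒x≢y {y = y} p x∈p-y refl = x∈p─q⇒x∉q p ⁅ y ⁆ x∈p-y (x∈⁅x⁆ y)

p-x⊆p : ∀ (p : Subset n) {x} → p - x ⊆ p
p-x⊆p p {x} = p─q⊆p p ⁅ x ⁆

x∉p⇒p-x≡p : ∀ {x : Fin n} {p} → x ∉ p → p - x ≡ p
x∉p⇒p-x≡p {p = p} x∉p = ⊆-antisym (p-x⊆p p) (λ y∈p → x∈p∧x≢y⇒x∈p-y y∈p λ { refl → x∉p y∈p })

x∉p⇒p∪⁅x⁆-x≡p : ∀ {x : Fin n} {p} → x ∉ p → (p ∪ ⁅ x ⁆) - x ≡ p
x∉p⇒p∪⁅x⁆-x≡p {x = x} {p} x∉p = ⊆-antisym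
  (λ y∈ → [ (λ y∈p → y∈p) , (λ y∈⁅x⁆ → ⊥-elim (x∈p-y⇒x≢y (p ∪ ⁅ x ⁆) y∈ (x∈⁅y⁆⇒x≡y x y∈⁅x⁆))) ]
            (x∈p∪q⁻ p ⁅ x ⁆ (p-x⊆p (p ∪ ⁅ x ⁆) y∈)))
  (λ y∈p → x∈p∧x≢y⇒x∈p-y (p⊆p∪q ⁅ x ⁆ y∈p) λ { refl → x∉p y∈p })

x∈p⇒p-x∪⁅x⁆≡p : ∀ {x : Fin n} {p} → x ∈ p → (p - x) ∪ ⁅ x ⁆ ≡ p
x∈p⇒p-x∪⁅x⁆≡p {x = x} {p} x∈p = ⊆-antisym (∪-least (p-x⊆p p) (x∈p⇒⁅x⁆⊆p x∈p)) λ {y} y∈p →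
  case y ≟ x of λ where
    (yes refl) → q⊆p∪q (p - x) ⁅ x ⁆ (x∈⁅x⁆ x)
    (no y≢x)   → p⊆p∪q ⁅ x ⁆ (x∈p∧x≢y⇒x∈p-y y∈p y≢x)

record IsFlat (N : Matroid n) (F : Subset n) : Set where
  field
    ⊆-ground : F ⊆ ground N
    rk-jumps : ∀ {j} → j ∈ ground N → j ∉ F → rk N F < rk N (F ∪ ⁅ j ⁆)

allB-sound : ∀ {p : A → Bool} xs → T (allB p xs) → ∀ {x} → x List.∈ xs → T (p x)
allB-sound {p = p} (y ∷ ys) t (here refl)  = proj₁ (T-∧⁻ (p y) t)
allB-sound {p = p} (y ∷ ys) t (there x∈ys) = allB-sound ys (proj₂ (T-∧⁻ (p y) t)) x∈ys

allB-complete : ∀ {p : A → Bool} xs → (∀ x → T (p x)) → T (allB p xs)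
allB-complete []       all-p = _
allB-complete (y ∷ ys) all-p = Equivalence.from T-∧ (all-p y , allB-complete ys all-p)

module _ {N : Matroid n} {F : Subset n} where

  isFlat⇒IsFlat : T (isFlat N F) → IsFlat N F
  isFlat⇒IsFlat F-flat = record
    { ⊆-ground = ⊆b⇒⊆ (proj₁ (T-∧⁻ (F ⊆b ground N) F-flat))
    ; rk-jumps = λ {j} j∈E j∉F → toWitness {a? = rk N F ℕ.<? rk N (F ∪ ⁅ j ⁆)}
        (T-guarded⁻ (j ∈b ground N) (j ∈b F) _
          (allB-sound (allFin n) (proj₂ (T-∧⁻ (F ⊆b ground N) F-flat)) (∈-allFin j))
          (fromWitness {a? = j ∈? ground N} j∈E) (j∉F ∘ toWitness {a? = j ∈? F}))
    }

  IsFlat⇒isFlat : IsFlat N F → T (isFlat N F)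
  IsFlat⇒isFlat F-flat = Equivalence.from T-∧ (⊆⇒⊆b ⊆-ground , allB-complete (allFin n) λ j →
    T-guarded⁺ (j ∈b ground N) (j ∈b F) _ λ j∈E j∈F →
      fromWitness {a? = rk N F ℕ.<? rk N (F ∪ ⁅ j ⁆)}
        (rk-jumps (toWitness {a? = j ∈? ground N} j∈E) (j∈F ∘ fromWitness {a? = j ∈? F})))
    where open IsFlat F-flat

ground-flat : ∀ (N : Matroid n) → T (isFlat N (ground N))
ground-flat N = IsFlat⇒isFlat {N = N} record
  { ⊆-ground = λ j∈E → j∈E ; rk-jumps = λ j∈E j∉E → ⊥-elim (j∉E j∈E) }

module _ (N : Matroid n) {Y F : Subset n} {j : Fin n}
         (Y⊆F : Y ⊆ F) (F⊆E : F ⊆ ground N) (j∈E : j ∈ ground N) where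

  rk-diminishing : rk N (F ∪ ⁅ j ⁆) ℕ.+ rk N Y ≤ rk N F ℕ.+ rk N (Y ∪ ⁅ j ⁆)
  rk-diminishing = ℕ.≤-trans (ℕ.+-mono-≤ rk-F∪j rk-Y) (rk-submod N F (Y ∪ ⁅ j ⁆) F⊆E Y∪j⊆E)
    where
    Y∪j⊆E : Y ∪ ⁅ j ⁆ ⊆ ground N
    Y∪j⊆E = ∪-least (⊆-trans Y⊆F F⊆E) (x∈p⇒⁅x⁆⊆p j∈E)
    rk-F∪j : rk N (F ∪ ⁅ j ⁆) ≤ rk N (F ∪ (Y ∪ ⁅ j ⁆))
    rk-F∪j = rk-mono N _ _ (∪-least F⊆E Y∪j⊆E)
      (∪-least (p⊆p∪q _) (⊆-trans (q⊆p∪q Y ⁅ j ⁆) (q⊆p∪q F _)))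
    rk-Y : rk N Y ≤ rk N (F ∩ (Y ∪ ⁅ j ⁆))
    rk-Y = rk-mono N _ _ (⊆-trans (p∩q⊆p F _) F⊆E) (λ y∈Y → x∈p∩q⁺ (Y⊆F y∈Y , p⊆p∪q ⁅ j ⁆ y∈Y))

  rk-jump-inherited : rk N F < rk N (F ∪ ⁅ j ⁆) → rk N Y < rk N (Y ∪ ⁅ j ⁆)
  rk-jump-inherited F<F∪j =
    ℕ.+-cancelˡ-< (rk N F) _ _ (ℕ.<-≤-trans (ℕ.+-monoˡ-< (rk N Y) F<F∪j) rk-diminishing)

-- Deleting an element

module Deletion (M : Matroid n) (i : Fin n) (i∈E : i ∈ ground M) where

  deletion-flat : ∀ {F} → T (isFlat M F) → T (isFlat (M ∖ i) (F - i))
  deletion-flat {F} F-flat = IsFlat⇒isFlat {N = M ∖ i} record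
    { ⊆-ground = λ x∈F-i → x∈p∧x≢y⇒x∈p-y (⊆-ground (p-x⊆p F x∈F-i)) (x∈p-y⇒x≢y F x∈F-i)
    ; rk-jumps = λ {j} j∈E-i j∉F-i →
        let j∈E = p-x⊆p (ground M) j∈E-i
            j∉F = λ j∈F → j∉F-i (x∈p∧x≢y⇒x∈p-y j∈F (x∈p-y⇒x≢y (ground M) j∈E-i))
        in rk-jump-inherited M (p-x⊆p F) ⊆-ground j∈E (rk-jumps j∈E j∉F)
    }
    where open IsFlat (isFlat⇒IsFlat {N = M} F-flat)

  -- On flats of M ∖ i this is the closure in M.
  closure : Subset n → Subset n
  closure y with rk M y ℕ.<? rk M (y ∪ ⁅ i ⁆)
  ... | yes _ = y
  ... | no  _ = y ∪ ⁅ i ⁆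

  module _ {y : Subset n} (y-flat : T (isFlat (M ∖ i) y)) where

    private
      open IsFlat (isFlat⇒IsFlat {N = M ∖ i} y-flat) renaming (⊆-ground to y⊆E-i; rk-jumps to y-jumps)
      y⊆E : y ⊆ ground M
      y⊆E = ⊆-trans y⊆E-i (p-x⊆p (ground M))
      i∉y : i ∉ y
      i∉y i∈y = x∈p-y⇒x≢y (ground M) (y⊆E-i i∈y) refl

    closure-flat : T (isFlat M (closure y))
    closure-flat with rk M y ℕ.<? rk M (y ∪ ⁅ i ⁆)
    ... | yes y<y∪i = IsFlat⇒isFlat {N = M} record
      { ⊆-ground = y⊆E
      ; rk-jumps = λ {j} j∈E j∉y → case j ≟ i of λ where
          (yes refl) → y<y∪i
          (no j≢i)   → y-jumps (x∈p∧x≢y⇒x∈p-y j∈E j≢i) j∉y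
      }
    ... | no y≮y∪i = IsFlat⇒isFlat {N = M} record
      { ⊆-ground = ∪-least y⊆E (x∈p⇒⁅x⁆⊆p i∈E)
      ; rk-jumps = λ {j} j∈E j∉y∪i →
          let j≢i : j ≢ i
              j≢i = λ { refl → j∉y∪i (q⊆p∪q y ⁅ i ⁆ (x∈⁅x⁆ i)) }
              y∪j⊆y∪i∪j = ∪-least (⊆-trans (p⊆p∪q ⁅ i ⁆) (p⊆p∪q ⁅ j ⁆)) (q⊆p∪q (y ∪ ⁅ i ⁆) ⁅ j ⁆)
              y∪i∪j⊆E = ∪-least (∪-least y⊆E (x∈p⇒⁅x⁆⊆p i∈E)) (x∈p⇒⁅x⁆⊆p j∈E)
          in ℕ.≤-<-trans (ℕ.≮⇒≥ y≮y∪i)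
               (ℕ.<-≤-trans (y-jumps (x∈p∧x≢y⇒x∈p-y j∈E j≢i) (j∉y∪i ∘ p⊆p∪q ⁅ i ⁆))
                            (rk-mono M _ _ y∪i∪j⊆E y∪j⊆y∪i∪j))
      }

    y⊆closure : y ⊆ closure y
    y⊆closure with rk M y ℕ.<? rk M (y ∪ ⁅ i ⁆)
    ... | yes _ = λ x∈y → x∈y
    ... | no  _ = p⊆p∪q ⁅ i ⁆

    closure⊣deletion : ∀ {X} → T (isFlat M X) → closure y ⊆ X ⇔ y ⊆ X - i
    closure⊣deletion {X} X-flat = mk⇔ to from
      where
      open IsFlat (isFlat⇒IsFlat {N = M} X-flat) renaming (⊆-ground to X⊆E; rk-jumps to X-jumps)
      to : closure y ⊆ X → y ⊆ X - i
      to cl⊆X x∈y = x∈p∧x≢y⇒x∈p-y (cl⊆X (y⊆closure x∈y)) (x∈p-y⇒x≢y (ground M) (y⊆E-i x∈y))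
      from : y ⊆ X - i → closure y ⊆ X
      from y⊆X-i with rk M y ℕ.<? rk M (y ∪ ⁅ i ⁆)
      ... | yes _    = ⊆-trans y⊆X-i (p-x⊆p X)
      ... | no y≮y∪i = case i ∈? X of λ where
        (yes i∈X) → ∪-least (⊆-trans y⊆X-i (p-x⊆p X)) (x∈p⇒⁅x⁆⊆p i∈X)
        (no i∉X)  → ⊥-elim (y≮y∪i (rk-jump-inherited M (⊆-trans y⊆X-i (p-x⊆p X)) X⊆E i∈E (X-jumps i∈E i∉X)))

    closure-i : closure y - i ≡ y
    closure-i with rk M y ℕ.<? rk M (y ∪ ⁅ i ⁆)
    ... | yes _ = x∉p⇒p-x≡p i∉y
    ... | no  _ = x∉p⇒p∪⁅x⁆-x≡p i∉y

  closure-ground : ¬ IsColoop M i → closure (ground M - i) ≡ ground M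
  closure-ground not-coloop with rk M (ground M - i) ℕ.<? rk M ((ground M - i) ∪ ⁅ i ⁆)
  ... | yes E-i<E = ⊥-elim (not-coloop (subst (λ Y → rk M (ground M - i) < rk M Y) (x∈p⇒p-x∪⁅x⁆≡p i∈E) E-i<E))
  ... | no  _     = x∈p⇒p-x∪⁅x⁆≡p i∈E

  μ-deletion : ¬ IsColoop M i → ∀ G →
    ΣSub (λ F → isFlat M F ∧ (F - i) ==S G) (μ/ M) ≡ (if isFlat (M ∖ i) G then μ/ (M ∖ i) G else + 0)
  μ-deletion not-coloop G = if-intro (isFlat (M ∖ i) G) (λ _ → flat-case) non-flat-case
    where
    flat-case : ΣSub (λ F → isFlat M F ∧ (F - i) ==S G) (μ/ M) ≡ μ/ (M ∖ i) G
    flat-case = begin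
      ΣSub (λ F → isFlat M F ∧ (F - i) ==S G) (λ F → μ M F (ground M))
        ≡⟨ rota-galois M (M ∖ i) (_- i) closure deletion-flat closure-flat
             (λ y-flat X-flat → closure⊣deletion y-flat X-flat) G (ground M) (ground-flat M) ⟩
      ΣSub (λ y → isFlat (M ∖ i) y ∧ closure y ==S ground M) (μ (M ∖ i) G)
        ≡⟨ ΣSub-unique (λ y y∈ → let (y-flat , cl-y≡E) = T-∧⁻ (isFlat (M ∖ i) y) y∈
                                 in trans (sym (closure-i y-flat)) (cong (_- i) (toWitness cl-y≡E))) ⟩
      (if isFlat (M ∖ i) (ground M - i) ∧ closure (ground M - i) ==S ground M
        then μ (M ∖ i) G (ground M - i) else + 0)
        ≡⟨ if-true (Equivalence.from T-∧ (ground-flat (M ∖ i) , fromWitness (closure-ground not-coloop))) ⟩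
      μ/ (M ∖ i) G ∎

    non-flat-case : ¬ T (isFlat (M ∖ i) G) → ΣSub (λ F → isFlat M F ∧ (F - i) ==S G) (μ/ M) ≡ + 0
    non-flat-case G-non-flat = ΣSub-zero _ λ F F∈ →
      let (F-flat , F-i≡G) = T-∧⁻ (isFlat M F) F∈
      in ⊥-elim (G-non-flat (subst (T ∘ isFlat (M ∖ i)) (toWitness F-i≡G) (deletion-flat F-flat)))

≟-shift : ∀ (k a b : ℤ) → ⌊ (k ℤ.- (a ℤ.- b)) ℤ.≟ b ⌋ ≡ ⌊ k ℤ.≟ a ⌋
≟-shift k a b = ⌊⌋-⇔ (mk⇔ to from) _ _
  where
  undo-shift : ∀ k a b → k ≡ k ℤ.- (a ℤ.- b) + (a ℤ.- b)
  undo-shift = solve-∀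
  shift-back : ∀ a b → b + (a ℤ.- b) ≡ a
  shift-back = solve-∀
  shift : ∀ a b → a ℤ.- (a ℤ.- b) ≡ b
  shift = solve-∀
  to : k ℤ.- (a ℤ.- b) ≡ b → k ≡ a
  to eq = trans (undo-shift k a b) (trans (cong (_+ (a ℤ.- b)) eq) (shift-back a b))
  from : k ≡ a → k ℤ.- (a ℤ.- b) ≡ b
  from refl = shift a b

ξ-shifted : ∀ (N : Matroid n) F k a → T (isFlat N F) →
  ξ N F (k ℤ.- (+ a ℤ.- + rk N F)) ≡ (if ⌊ k ℤ.≟ + a ⌋ then μ/ N F else + 0)
ξ-shifted N F k a F-flat =
  cong₂ (λ b c → if b ∧ c then μ/ N F else + 0) (T⇒≡true F-flat) (≟-shift k (+ a) (+ rk N F))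

lemma3p4 : ∀ {n} (M : Matroid n) (i : Fin n) →
    Loopless M → i ∈ ground M → ¬ IsColoop M i →
    ∀ (G : Subset n) (k : ℤ) → Δ M i (ξ M) G k ≡ ξ (M ∖ i) G k
lemma3p4 M i _ i∈E not-coloop G k = begin
  Δ M i (ξ M) G k
    ≡⟨ ΣSub-cong fibre (λ F F∈ →
         let (F-flat , F-i≡G) = T-∧⁻ (isFlat M F) F∈
         in trans (ξ-shifted M F k (rk M (F - i)) F-flat)
                  (cong (λ Y → if ⌊ k ℤ.≟ + rk M Y ⌋ then μ/ M F else + 0) (toWitness F-i≡G))) ⟩
  ΣSub fibre (λ F → if k≟rkG then μ/ M F else + 0)
    ≡⟨ ΣSub-if fibre k≟rkG (μ/ M) ⟩
  (if k≟rkG then ΣSub fibre (μ/ M) else + 0)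
    ≡⟨ cong (λ s → if k≟rkG then s else + 0) (μ-deletion not-coloop G) ⟩
  (if k≟rkG then (if isFlat (M ∖ i) G then μ/ (M ∖ i) G else + 0) else + 0)
    ≡⟨ trans (if-swap k≟rkG (isFlat (M ∖ i) G)) (if-∧ (isFlat (M ∖ i) G) k≟rkG) ⟩
  ξ (M ∖ i) G k ∎
  where
  open Deletion M i i∈E
  fibre : Subset _ → Bool
  fibre F = isFlat M F ∧ (F - i) ==S G
  k≟rkG : Bool
  k≟rkG = ⌊ k ℤ.≟ + rk M G ⌋
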